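{- Let $n \ge 3$ and let $\Gamma$ be a first-kind Frobenius circulant with kernel $\mathbb{Z}_n$. Then $n$ is odd and $\Gamma$ has even degree.
   Context: $\mathbb{Z}_n$ is the additive group mod $n$ and $\mathbb{Z}_n^*\cong\mathrm{Aut}(\mathbb{Z}_n)$ its unit group acting by multiplication. $\mathrm{Cay}(G,S)$ (with $1\notin S=S^{ -1}$) has vertex set $G$, $g\sim h$ iff $gh^{ -1}\in S$. A Frobenius group is a transitive non-regular permutation group in which only the identity fixes two points. For $H\le\mathbb{Z}_n^*$ such that $\mathbb{Z}_n\rtimes H$ (acting on $\mathbb{Z}_n$ by $[x]^{([y],[u])}=[(x+y)u]$) is a Frobenius group, a first-kind Frobenius circulant with kernel $\mathbb{Z}_n$ and complement $H$ is a connected $\mathrm{Cay}(\mathbb{Z}_n,S)$ with $S=a^H$ for some $a\in\mathbb{Z}_n$ with $\langle a^H\rangle=\mathbb{Z}_n$, where $|H|$ is even or $a$ is an involution. -}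

module Defs where

open import Data.Nat using (ℕ; zero; suc; _+_; _*_; _∸_; _<_; NonZero)
open import Data.Nat.Properties using (_≟_)
open import Data.Nat.DivMod using (_%_)
open import Data.Nat.Divisibility using (_∣_)
open import Data.List using (List; map; length; deduplicate)
open import Data.List.Membership.Propositional using (_∈_; _∉_)
open import Data.List.Relation.Unary.All using (All)
open import Data.List.Relation.Unary.Unique.Propositional using (Unique)
open import Data.Sum using (_⊎_)
open import Data.Product using (Σ; ∃; _×_)
open import Relation.Binary.PropositionalEquality using (_≡_; _≢_)
open import Relation.Nullary using (¬_)

-- Elements of ℤ_n are represented by their canonical residues x < n (x : ℕ);
-- the group operations are computed modulo n.

module _ (n : ℕ) .{{_ : NonZero n}} where

  IsUnit : ℕ → Set
  IsUnit u = ∃ λ v → (u * v) % n ≡ 1 % n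

  record IsUnitSubgroup (H : List ℕ) : Set where
    field
      reduced  : All (λ h → h < n) H
      distinct : Unique H
      units    : All IsUnit H
      one∈     : 1 % n ∈ H
      mul∈     : ∀ {h k} → h ∈ H → k ∈ H → (h * k) % n ∈ H
      inv∈     : ∀ {h} → h ∈ H → ∃ λ k → k ∈ H × (h * k) % n ≡ 1 % n

  -- the action of ([y],[u]) ∈ ℤ_n ⋊ H on ℤ_n :  [x] ↦ [(x + y) u]
  act : ℕ → ℕ → ℕ → ℕ
  act y u x = ((x + y) * u) % n

  IsIdentity : ℕ → ℕ → Set
  IsIdentity y u = (y ≡ 0) × (u ≡ 1 % n)

  record IsFrobenius (H : List ℕ) : Set where
    field
      transitive : ∀ x x' → x < n → x' < n →
                   ∃ λ y → ∃ λ u → y < n × u ∈ H × act y u x ≡ x'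
      nonRegular : ∃ λ y → ∃ λ u → y < n × u ∈ H × ¬ IsIdentity y u ×
                   ∃ λ x → x < n × act y u x ≡ x
      twoPoint   : ∀ y u x₁ x₂ → y < n → u ∈ H → x₁ < n → x₂ < n → x₁ ≢ x₂ →
                   act y u x₁ ≡ x₁ → act y u x₂ ≡ x₂ → IsIdentity y u

  orbit : List ℕ → ℕ → List ℕ
  orbit H a = deduplicate _≟_ (map (λ h → (a * h) % n) H)

  neg : ℕ → ℕ
  neg x = (n ∸ x) % n

  data Gen (S : List ℕ) : ℕ → Set where
    gen-zero : Gen S 0
    gen-elem : ∀ {x} → x ∈ S → Gen S x
    gen-add  : ∀ {x y} → Gen S x → Gen S y → Gen S ((x + y) % n)
    gen-neg  : ∀ {x} → Gen S x → Gen S (neg x)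

  Generates : List ℕ → Set
  Generates S = ∀ x → x < n → Gen S x

  IsConnectionSet : List ℕ → Set
  IsConnectionSet S = (0 ∉ S) × (∀ {x} → x ∈ S → neg x ∈ S)

  IsInvolution : ℕ → Set
  IsInvolution a = (a ≢ 0) × ((a + a) % n ≡ 0)

  -- Cay(ℤ_n, a^H) is a first-kind Frobenius circulant with kernel ℤ_n and complement H
  -- (connectedness of a Cayley graph = ⟨a^H⟩ = ℤ_n; its degree is |a^H|)
  record FirstKindFrobeniusCirculant (H : List ℕ) (a : ℕ) : Set where
    field
      subgroup   : IsUnitSubgroup H
      frobenius  : IsFrobenius H
      a<n        : a < n
      cayley     : IsConnectionSet (orbit H a)
      generating : Generates (orbit H a)
      evenOrInv  : (2 ∣ length H) ⊎ IsInvolution a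

-- A multiplier u ∈ H fixes 0, so by the Frobenius condition it fixes no other
-- point unless u = 1; non-regularity forces some u ≠ 1 in H. If n = 2m, every unit u is
-- odd and then fixes m as well, so n is odd. The same condition makes h ↦ a h injective
-- on H (a ≠ 0 since 0 ∉ a^H), so the degree |a^H| equals |H|; this is even unless a is an
-- involution, which would need 2a = n and hence n even.
module Submission where

open import Defs
open import Data.Nat using (ℕ; zero; suc; _+_; _*_; _<_; _≤_; _%_; _/_; NonZero; s≤s; z≤n; ≢-nonZero; ≢-nonZero⁻¹; >-nonZero⁻¹)
open import Data.Nat.Properties
open import Data.Nat.DivMod using (m≡m%n+[m/n]*n; m%n<n; m<n⇒m%n≡m; m%n%n≡m%n; %-distribˡ-*; [m+kn]%n≡m%n)
open import Data.Nat.Divisibility using (_∣_; divides; m%n≡0⇒n∣m; ∣m∣n⇒∣m+n; ∣m+n∣m⇒∣n; ∣n⇒∣m*n; ∣m⇒∣m*n; ∣1⇒≡1; _∣?_)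
open import Data.Nat.Tactic.RingSolver using (solve-∀)
open import Data.List using (List; []; _∷_; map; length; deduplicate; filter)
open import Data.List.Properties using (filter-all; length-map)
open import Data.List.Membership.Propositional using (_∈_)
open import Data.List.Membership.Propositional.Properties using (∈-map⁺; ∈-deduplicate⁺)
open import Data.List.Relation.Unary.All as All using (All; []; _∷_)
open import Data.List.Relation.Unary.Any using (here; there)
open import Data.List.Relation.Unary.AllPairs using ([]; _∷_)
open import Data.List.Relation.Unary.Unique.Propositional using (Unique)
open import Data.Product using (_×_; ∃; _,_; proj₁; proj₂)
open import Data.Sum using (inj₁; inj₂)
open import Relation.Nullary using (¬_; ¬?; yes; no; contradiction)
open import Relation.Binary.Definitions using (DecidableEquality)
open import Function.Bundles using (_⇔_; mk⇔; Equivalence)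
open import Relation.Binary.PropositionalEquality

module _ {A : Set} (_≟ᴬ_ : DecidableEquality A) where

  deduplicate-unique : ∀ {xs} → Unique xs → deduplicate _≟ᴬ_ xs ≡ xs
  deduplicate-unique {[]} [] = refl
  deduplicate-unique {x ∷ xs} (x∉xs ∷ xs!) =
    cong (x ∷_) (trans (cong (filter (λ y → ¬? (x ≟ᴬ y))) (deduplicate-unique xs!))
                       (filter-all (λ y → ¬? (x ≟ᴬ y)) x∉xs))

module _ {A B : Set} (f : A → B) where

  map⁺-injectiveOn : ∀ {xs} → (∀ {x y} → x ∈ xs → y ∈ xs → f x ≡ f y → x ≡ y) →
                     Unique xs → Unique (map f xs)
  map⁺-injectiveOn {[]} inj [] = []
  map⁺-injectiveOn {x ∷ xs} inj (x∉xs ∷ xs!) =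
    distinct-images there x∉xs ∷ map⁺-injectiveOn (λ p q → inj (there p) (there q)) xs!
    where
      distinct-images : ∀ {ys} → (∀ {y} → y ∈ ys → y ∈ x ∷ xs) →
                        All (x ≢_) ys → All (f x ≢_) (map f ys)
      distinct-images {[]} _ [] = []
      distinct-images {y ∷ ys} sub (x≢y ∷ rest) =
        (λ fx≡fy → x≢y (inj (here refl) (sub (here refl)) fx≡fy))
        ∷ distinct-images (λ p → sub (there p)) rest

odd≡1+[m/2]*2 : ∀ u → ¬ 2 ∣ u → u ≡ 1 + (u / 2) * 2
odd≡1+[m/2]*2 u 2∤u with u % 2 | m%n<n u 2 | m≡m%n+[m/n]*n u 2
... | zero          | _               | u≡2q   = contradiction (divides (u / 2) u≡2q) 2∤u
... | suc zero      | _               | u≡1+2q = u≡1+2q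
... | suc (suc _)   | s≤s (s≤s ())    | _

module _ {n : ℕ} .{{_ : NonZero n}} where

  %-congʳ-* : ∀ m {a b} → a % n ≡ b % n → (m * a) % n ≡ (m * b) % n
  %-congʳ-* m {a} {b} a≡b = begin
    (m * a) % n              ≡⟨ %-distribˡ-* m a n ⟩
    ((m % n) * (a % n)) % n  ≡⟨ cong (λ z → ((m % n) * z) % n) a≡b ⟩
    ((m % n) * (b % n)) % n  ≡⟨ %-distribˡ-* m b n ⟨
    (m * b) % n              ∎
    where open ≡-Reasoning

  %-congˡ-* : ∀ m {a b} → a % n ≡ b % n → (a * m) % n ≡ (b * m) % n
  %-congˡ-* m {a} {b} a≡b rewrite *-comm a m | *-comm b m = %-congʳ-* m a≡b

  m*[n%d]%d≡m*n%d : ∀ a b → (a * (b % n)) % n ≡ (a * b) % n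
  m*[n%d]%d≡m*n%d a b = %-congʳ-* a (m%n%n≡m%n b n)

  0%n≡0 : 0 % n ≡ 0
  0%n≡0 = m<n⇒m%n≡m (>-nonZero⁻¹ n)

  [m+n]%d≡m⇒n≡0 : ∀ m {k} → k < n → (m + k) % n ≡ m → k ≡ 0
  [m+n]%d≡m⇒n≡0 m {k} k<n eq = multiple<n⇒0 ((m + k) / n) (+-cancelˡ-≡ m k _ m+k≡m+q*n)
    where
      m+k≡m+q*n : m + k ≡ m + ((m + k) / n) * n
      m+k≡m+q*n = trans (m≡m%n+[m/n]*n (m + k) n) (cong (_+ ((m + k) / n) * n) eq)
      multiple<n⇒0 : ∀ q → k ≡ q * n → k ≡ 0
      multiple<n⇒0 zero k≡0 = k≡0
      multiple<n⇒0 (suc q) k≡n+q*n = contradiction (subst (n ≤_) (sym k≡n+q*n) (m≤m+n n (q * n))) (<⇒≱ k<n)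

  ∣m%n⇔∣m : ∀ {d m} → d ∣ n → d ∣ m % n ⇔ d ∣ m
  ∣m%n⇔∣m {d} {m} d∣n = mk⇔
    (λ d∣m%n → subst (d ∣_) (sym m≡) (∣m∣n⇒∣m+n d∣m%n d∣q*n))
    (λ d∣m → ∣m+n∣m⇒∣n (subst (d ∣_) (trans m≡ (+-comm (m % n) _)) d∣m) d∣q*n)
    where
      m≡ : m ≡ m % n + (m / n) * n
      m≡ = m≡m%n+[m/n]*n m n
      d∣q*n : d ∣ (m / n) * n
      d∣q*n = ∣n⇒∣m*n (m / n) d∣n

  ∣unit⇒∣1 : ∀ {d u} → d ∣ n → d ∣ u → IsUnit n u → d ∣ 1
  ∣unit⇒∣1 {d} {u} d∣n d∣u (v , uv≡1) =
    to (∣m%n⇔∣m d∣n) (subst (d ∣_) uv≡1 (from (∣m%n⇔∣m d∣n) (∣m⇒∣m*n v d∣u)))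
    where open Equivalence

  half≢0 : ∀ {m} → n ≡ m * 2 → m ≢ 0
  half≢0 n≡2m m≡0 = ≢-nonZero⁻¹ n (trans n≡2m (cong (_* 2) m≡0))

  half<n : ∀ {m} → n ≡ m * 2 → m < n
  half<n {m} n≡2m = subst (m <_) (sym n≡2m) (m<m*n m 2 {{≢-nonZero (half≢0 n≡2m)}} (s≤s (s≤s z≤n)))

  odd-fixes-half : ∀ {m u} → n ≡ m * 2 → ¬ 2 ∣ u → act n 0 u m ≡ m
  odd-fixes-half {m} {u} n≡2m 2∤u = begin
    ((m + 0) * u) % n              ≡⟨ cong (λ z → ((m + 0) * z) % n) (odd≡1+[m/2]*2 u 2∤u) ⟩
    ((m + 0) * (1 + k * 2)) % n    ≡⟨ cong (_% n) (expand m k) ⟩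
    (m + k * (m * 2)) % n          ≡⟨ cong (λ z → (m + k * z) % n) n≡2m ⟨
    (m + k * n) % n                ≡⟨ [m+kn]%n≡m%n m k n ⟩
    m % n                          ≡⟨ m<n⇒m%n≡m (half<n n≡2m) ⟩
    m                              ∎
    where
      open ≡-Reasoning
      k = u / 2
      expand : ∀ m k → (m + 0) * (1 + k * 2) ≡ m + k * (m * 2)
      expand = solve-∀

  n∣m<2n⇒m≡n : ∀ {m} → n ∣ m → 0 < m → m < n + n → m ≡ n
  n∣m<2n⇒m≡n (divides zero m≡0) 0<m _ = contradiction m≡0 (>⇒≢ 0<m)
  n∣m<2n⇒m≡n (divides (suc zero) m≡n) _ _ = trans m≡n (+-identityʳ n)
  n∣m<2n⇒m≡n {m} (divides (suc (suc q)) m≡) _ m<2n =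
    contradiction (subst (n + n ≤_) (sym m≡) (+-monoʳ-≤ n (m≤m+n n (q * n)))) (<⇒≱ m<2n)

  involution⇒2∣n : ∀ {a} → a < n → IsInvolution n a → 2 ∣ n
  involution⇒2∣n {a} a<n (a≢0 , 2a%n≡0) =
    divides a (sym (trans (*-comm a 2) (trans (cong (a +_) (+-identityʳ a)) 2a≡n)))
    where
      2a≡n : a + a ≡ n
      2a≡n = n∣m<2n⇒m≡n (m%n≡0⇒n∣m (a + a) n 2a%n≡0)
               (<-≤-trans (n≢0⇒n>0 a≢0) (m≤m+n a a)) (+-mono-< a<n a<n)

  common-inverse⇒≡ : ∀ {h k k'} → (k * k') % n ≡ 1 % n → (h * k') % n ≡ 1 % n → h % n ≡ k % n
  common-inverse⇒≡ {h} {k} {k'} kk'≡1 hk'≡1 = begin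
    h % n                ≡⟨ cong (_% n) (*-identityʳ h) ⟨
    (h * 1) % n          ≡⟨ %-congʳ-* h k'k≡1 ⟨
    (h * (k' * k)) % n   ≡⟨ cong (_% n) (*-assoc h k' k) ⟨
    ((h * k') * k) % n   ≡⟨ %-congˡ-* k hk'≡1 ⟩
    (1 * k) % n          ≡⟨ cong (_% n) (*-identityˡ k) ⟩
    k % n                ∎
    where
      open ≡-Reasoning
      k'k≡1 : (k' * k) % n ≡ 1 % n
      k'k≡1 = trans (cong (_% n) (*-comm k' k)) kk'≡1

  quotient-fixes : ∀ {a h k k'} → (a * h) % n ≡ (a * k) % n → (k * k') % n ≡ 1 % n →
                   (a * (h * k')) % n ≡ a % n
  quotient-fixes {a} {h} {k} {k'} ah≡ak kk'≡1 = begin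
    (a * (h * k')) % n   ≡⟨ cong (_% n) (*-assoc a h k') ⟨
    ((a * h) * k') % n   ≡⟨ %-congˡ-* k' ah≡ak ⟩
    ((a * k) * k') % n   ≡⟨ cong (_% n) (*-assoc a k k') ⟩
    (a * (k * k')) % n   ≡⟨ %-congʳ-* a kk'≡1 ⟩
    (a * 1) % n          ≡⟨ cong (_% n) (*-identityʳ a) ⟩
    a % n                ∎
    where open ≡-Reasoning

module _ {n : ℕ} .{{_ : NonZero n}} {H : List ℕ} (frobenius : IsFrobenius n H) where
  open IsFrobenius frobenius

  fixes-0-and-x⇒≡1 : ∀ {u x} → u ∈ H → x < n → x ≢ 0 → act n 0 u x ≡ x → u ≡ 1 % n
  fixes-0-and-x⇒≡1 {u} {x} u∈H x<n x≢0 fix =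
    proj₂ (twoPoint 0 u 0 x 0<n u∈H 0<n x<n (λ 0≡x → x≢0 (sym 0≡x)) 0%n≡0 fix)
    where
      0<n : 0 < n
      0<n = >-nonZero⁻¹ n

  nontrivial-complement : ∃ λ u → u ∈ H × u ≢ 1 % n
  nontrivial-complement with nonRegular
  ... | y , u , y<n , u∈H , ¬id , x , _ , fix = u , u∈H , λ u≡1 → ¬id ([m+n]%d≡m⇒n≡0 x y<n (x+y≡x u≡1) , u≡1)
    where
      x+y≡x : u ≡ 1 % n → (x + y) % n ≡ x
      x+y≡x u≡1 = begin
        (x + y) % n               ≡⟨ cong (_% n) (*-identityʳ (x + y)) ⟨
        ((x + y) * 1) % n         ≡⟨ m*[n%d]%d≡m*n%d (x + y) 1 ⟨
        ((x + y) * (1 % n)) % n   ≡⟨ cong (λ v → ((x + y) * v) % n) u≡1 ⟨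
        ((x + y) * u) % n         ≡⟨ fix ⟩
        x                         ∎
        where open ≡-Reasoning

  Frobenius⇒odd : All (IsUnit n) H → ¬ 2 ∣ n
  Frobenius⇒odd units 2∣n@(divides m n≡2m) with nontrivial-complement
  ... | u , u∈H , u≢1 with 2 ∣? u
  ...   | yes 2∣u = contradiction (∣1⇒≡1 (∣unit⇒∣1 2∣n 2∣u (All.lookup units u∈H))) λ ()
  ...   | no 2∤u  = u≢1 (fixes-0-and-x⇒≡1 u∈H (half<n {m = m} n≡2m) (half≢0 {m = m} n≡2m)
                                             (odd-fixes-half {m = m} n≡2m 2∤u))

  orbit-map-injective : IsUnitSubgroup n H → ∀ {a} → a < n → a ≢ 0 →
                         ∀ {h k} → h ∈ H → k ∈ H → (a * h) % n ≡ (a * k) % n → h ≡ k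
  orbit-map-injective subgroup {a} a<n a≢0 {h} {k} h∈H k∈H ah≡ak with IsUnitSubgroup.inv∈ subgroup k∈H
  ... | k' , k'∈H , kk'≡1 = begin
    h      ≡⟨ m<n⇒m%n≡m (All.lookup reduced h∈H) ⟨
    h % n  ≡⟨ common-inverse⇒≡ kk'≡1 hk'≡1 ⟩
    k % n  ≡⟨ m<n⇒m%n≡m (All.lookup reduced k∈H) ⟩
    k      ∎
    where
      open ≡-Reasoning
      open IsUnitSubgroup subgroup
      fix : act n 0 ((h * k') % n) a ≡ a
      fix = begin
        ((a + 0) * ((h * k') % n)) % n   ≡⟨ m*[n%d]%d≡m*n%d (a + 0) (h * k') ⟩
        ((a + 0) * (h * k')) % n         ≡⟨ cong (λ b → (b * (h * k')) % n) (+-identityʳ a) ⟩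
        (a * (h * k')) % n               ≡⟨ quotient-fixes ah≡ak kk'≡1 ⟩
        a % n                            ≡⟨ m<n⇒m%n≡m a<n ⟩
        a                                ∎
      hk'≡1 : (h * k') % n ≡ 1 % n
      hk'≡1 = fixes-0-and-x⇒≡1 (mul∈ h∈H k'∈H) a<n a≢0 fix

module _ {n : ℕ} .{{_ : NonZero n}} {H : List ℕ} (a : ℕ) where

  ∈-orbit : ∀ {h} → h ∈ H → (a * h) % n ∈ orbit n H a
  ∈-orbit h∈H = ∈-deduplicate⁺ _≟_ (∈-map⁺ (λ h → (a * h) % n) h∈H)

  length-orbit : Unique H → (∀ {h k} → h ∈ H → k ∈ H → (a * h) % n ≡ (a * k) % n → h ≡ k) →
                 length (orbit n H a) ≡ length H
  length-orbit H! inj = begin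
    length (deduplicate _≟_ (map ah H))  ≡⟨ cong length (deduplicate-unique _≟_ (map⁺-injectiveOn ah inj H!)) ⟩
    length (map ah H)                    ≡⟨ length-map ah H ⟩
    length H                             ∎
    where
      open ≡-Reasoning
      ah : ℕ → ℕ
      ah h = (a * h) % n

lemma2p3 : (n : ℕ) .{{_ : NonZero n}} → 3 ≤ n → (H : List ℕ) → (a : ℕ) →
           FirstKindFrobeniusCirculant n H a →
           (¬ (2 ∣ n)) × (2 ∣ length (orbit n H a))
lemma2p3 n _ H a F = n-odd , degree-even
  where
    open FirstKindFrobeniusCirculant F
    open IsUnitSubgroup subgroup

    n-odd : ¬ 2 ∣ n
    n-odd = Frobenius⇒odd frobenius units

    a≢0 : a ≢ 0
    a≢0 refl = proj₁ cayley (subst (_∈ orbit n H 0) 0%n≡0 (∈-orbit 0 one∈))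

    degree≡|H| : length (orbit n H a) ≡ length H
    degree≡|H| = length-orbit a distinct (orbit-map-injective frobenius subgroup a<n a≢0)

    degree-even : 2 ∣ length (orbit n H a)
    degree-even with evenOrInv
    ... | inj₁ 2∣|H|  = subst (2 ∣_) (sym degree≡|H|) 2∣|H|
    ... | inj₂ a-inv = contradiction (involution⇒2∣n a<n a-inv) n-odd
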